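{- Let $G_7$ be the graph with vertex set $\{x_1,\dots,x_8\}$ and edge set $\{x_1x_2, x_1x_3, x_2x_3, x_4x_5, x_4x_6, x_5x_6, x_1x_4, x_2x_5, x_3x_6, x_1x_7, x_5x_7, x_2x_8, x_4x_8\}$. Let $G$ be a clique expansion of $G_7$, and assume that every proper induced subgraph $G'$ of $G$ satisfies $\chi(G')\le \lceil\frac{5}{4}\omega(G')\rceil$. Then $\chi(G)\le \lceil\frac{5}{4}\omega(G)\rceil$.
   Context: A clique expansion of a graph $H$ is any graph $G$ whose vertex set can be partitioned into $|V(H)|$ non-empty cliques $Q_v$, $v\in V(H)$, such that every vertex of $Q_u$ is adjacent to every vertex of $Q_v$ whenever $uv\in E(H)$, and no vertex of $Q_u$ is adjacent to any vertex of $Q_v$ whenever $u\neq v$ and $uv\notin E(H)$. $\chi$ denotes the chromatic number and $\omega$ the clique number. -}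

module Defs where

open import Data.Nat using (ℕ; zero; suc; _*_; _+_; _≤_; _/_)
open import Data.Bool using (Bool; true; false; _∨_; T)
open import Data.Fin using (Fin; toℕ)
open import Data.Fin.Subset using (Subset; _∈_; _∉_; _⊆_; ∣_∣)
open import Data.Product using (Σ; ∃; _×_; _,_)
open import Data.Sum using (_⊎_)
open import Relation.Binary.PropositionalEquality using (_≡_; _≢_)
open import Relation.Nullary using (¬_; Dec)
open import Function.Bundles using (_⇔_)

record Graph (n : ℕ) : Set₁ where
  field
    Adj   : Fin n → Fin n → Set
    adj?  : ∀ u v → Dec (Adj u v)
    sym   : ∀ {u v} → Adj u v → Adj v u
    irrefl : ∀ {u} → ¬ Adj u u
open Graph public

IsCliqueIn : ∀ {n} → Graph n → Subset n → Subset n → Set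
IsCliqueIn G S C = C ⊆ S × (∀ u v → u ∈ C → v ∈ C → u ≢ v → Adj G u v)

IsCliqueNumberIn : ∀ {n} → Graph n → Subset n → ℕ → Set
IsCliqueNumberIn G S w =
  (Σ (Subset _) λ C → IsCliqueIn G S C × ∣ C ∣ ≡ w) ×
  (∀ C → IsCliqueIn G S C → ∣ C ∣ ≤ w)

ColourableIn : ∀ {n} → Graph n → Subset n → ℕ → Set
ColourableIn G S k =
  Σ ((v : Fin _) → v ∈ S → Fin k) λ c →
    ∀ u v (u∈ : u ∈ S) (v∈ : v ∈ S) → Adj G u v → c u u∈ ≢ c v v∈

ceil5/4 : ℕ → ℕ
ceil5/4 w = (5 * w + 3) / 4

-- The graph G₇, with x_i represented by the element i-1 of Fin 8.
e7 : ℕ → ℕ → Bool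
e7 0 1 = true
e7 0 2 = true
e7 1 2 = true
e7 3 4 = true
e7 3 5 = true
e7 4 5 = true
e7 0 3 = true
e7 1 4 = true
e7 2 5 = true
e7 0 6 = true
e7 4 6 = true
e7 1 7 = true
e7 3 7 = true
e7 _ _ = false

G7Adj : Fin 8 → Fin 8 → Set
G7Adj i j = T (e7 (toℕ i) (toℕ j) ∨ e7 (toℕ j) (toℕ i))

-- G is a clique expansion of the graph H on Fin m, witnessed by f : V(G) → V(H)
-- (Q_x = f⁻¹(x)): each Q_x is non-empty, each Q_x is a clique, Q_x complete to Q_y
-- when xy ∈ E(H), anticomplete when x ≠ y and xy ∉ E(H).
IsCliqueExpansion : ∀ {n m} → Graph n → (Fin m → Fin m → Set) → (Fin n → Fin m) → Set
IsCliqueExpansion G HAdj f =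
  (∀ x → ∃ λ v → f v ≡ x) ×
  (∀ u v → u ≢ v → (Adj G u v ⇔ (f u ≡ f v ⊎ HAdj (f u) (f v))))

-- Let the weight of a vertex x of G₇ be |Q_x|, and call a maximal clique of G₇ tight when its weight
-- is ω = ω(G); every clique of G lies in the preimage of a maximal clique, so no weight exceeds ω.
-- If a stable set s of G₇ meets every tight clique, deleting one vertex of Q_x for each x ∈ s leaves
-- a graph of smaller clique number, which minimality colours with ⌈5(ω-1)/4⌉ colours; the deleted
-- vertices are pairwise non-adjacent and take one more colour. A finite check over all sets of tight
-- cliques shows that otherwise two of the matching edges x₁x₄, x₂x₅, x₃x₆ are tight, which the
-- triangles x₁x₂x₃, x₄x₅x₆ (covering the same vertices) forbid, or all cliques but x₁x₄ and x₂x₅ are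
-- tight. In that case the closed neighbourhood of x₇ or of x₈ has weight at most ⌈5ω/4⌉, so a vertex
-- of Q_{x₇} or Q_{x₈} has fewer neighbours than colours and can be coloured after the rest of G.

module Submission where

open import Data.Bool using (true; false; T; _∨_)
open import Data.Bool.Properties using (T?; ∨-comm)
open import Data.Empty using (⊥-elim)
open import Data.Fin as Fin using (Fin; zero; suc; #_; toℕ; inject₁; inject≤; fromℕ; punchIn; punchOut)
open import Data.Fin.Properties
  using (all?; any?; inject≤-injective; inject₁-injective; fromℕ≢inject₁;
         punchIn-injective; punchIn-punchOut; punchInᵢ≢i)
open import Data.Fin.Subset
open import Data.Fin.Subset.Properties
open import Data.Nat using (ℕ; zero; suc; _+_; _*_; _≤_; _<_; _/_; NonZero; s≤s)
open import Data.Nat.Properties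
  using (≤-refl; ≤-trans; ≤-reflexive; <-≤-trans; ≤-<-trans; ≤-total; ≤∧≢⇒<; <-irrefl;
         +-suc; +-comm; +-cancelʳ-≡; +-monoˡ-≤; +-monoʳ-≤; +-mono-≤; *-monoʳ-≤;
         m≤m+n; n≤1+n; m<m+n; m<n+m; +-monoʳ-<; module ≤-Reasoning)
  renaming (_≟_ to _≟ℕ_)
open import Data.Nat.DivMod using (m*n/n≡m; /-monoˡ-≤; m/n*n≤m)
open import Data.Nat.Tactic.RingSolver using (solve-∀)
open import Data.Product using (∃; _×_; _,_; proj₁; proj₂; uncurry) renaming (map to ×-map)
open import Data.Sum using (_⊎_; inj₁; inj₂; [_,_]′) renaming (map to ⊎-map)
open import Data.Vec as Vec using (_∷_; []; lookup; tabulate; here; there)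
open import Data.Vec.Properties using (lookup∘tabulate; []=⇒lookup; lookup⇒[]=)
open import Function.Bundles using (Equivalence)
open import Relation.Binary.PropositionalEquality
open import Relation.Nullary using (Dec; yes; no; ¬_; ¬?; does)
open import Relation.Nullary.Decidable using (_×-dec_; _⊎-dec_; _→-dec_; from-yes; dec-true; True; toWitness)
open import Relation.Unary using (Pred; Decidable)
open import Defs hiding (sym)

-- Finite sets

subsetOf : ∀ {n p} {P : Pred (Fin n) p} → Decidable P → Subset n
subsetOf P? = tabulate (λ i → does (P? i))

module _ {n p} {P : Pred (Fin n) p} (P? : Decidable P) where

  ∈-subsetOf⁺ : ∀ {i} → P i → i ∈ subsetOf P?
  ∈-subsetOf⁺ {i} Pi = lookup⇒[]= i _ (trans (lookup∘tabulate _ i) (dec-true (P? i) Pi))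

  ∈-subsetOf⁻ : ∀ {i} → i ∈ subsetOf P? → P i
  ∈-subsetOf⁻ {i} i∈ with P? i | trans (sym (lookup∘tabulate (λ j → does (P? j)) i)) ([]=⇒lookup i∈)
  ... | yes Pi | _ = Pi
  ... | no _   | ()

allSubset? : ∀ {n p} {P : Pred (Subset n) p} → Decidable P → Dec (∀ q → P q)
allSubset? {zero} P? with P? []
... | yes P[] = yes λ { [] → P[] }
... | no ¬P[] = no λ ∀P → ¬P[] (∀P [])
allSubset? {suc n} P? with allSubset? (λ q → P? (inside ∷ q)) | allSubset? (λ q → P? (outside ∷ q))
... | yes Pin | yes Pout = yes λ { (true ∷ q) → Pin q ; (false ∷ q) → Pout q }
... | no ¬Pin | _        = no λ ∀P → ¬Pin (λ q → ∀P (inside ∷ q))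
... | yes _   | no ¬Pout = no λ ∀P → ¬Pout (λ q → ∀P (outside ∷ q))

∈-irrelevant : ∀ {n} {p : Subset n} {x} (a b : x ∈ p) → a ≡ b
∈-irrelevant here      here      = refl
∈-irrelevant (there a) (there b) = cong there (∈-irrelevant a b)

∣p∪q∣≡∣p∣+∣q∣ : ∀ {n} {p q : Subset n} → p ∩ q ≡ ⊥ → ∣ p ∪ q ∣ ≡ ∣ p ∣ + ∣ q ∣
∣p∪q∣≡∣p∣+∣q∣ {p = []}        {[]}        _  = refl
∣p∪q∣≡∣p∣+∣q∣ {p = true ∷ p}  {false ∷ q} eq = cong suc (∣p∪q∣≡∣p∣+∣q∣ (cong Vec.tail eq))
∣p∪q∣≡∣p∣+∣q∣ {p = false ∷ p} {true ∷ q}  eq =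
  trans (cong suc (∣p∪q∣≡∣p∣+∣q∣ (cong Vec.tail eq))) (sym (+-suc ∣ p ∣ ∣ q ∣))
∣p∪q∣≡∣p∣+∣q∣ {p = false ∷ p} {false ∷ q} eq = ∣p∪q∣≡∣p∣+∣q∣ (cong Vec.tail eq)

maximum-subset : ∀ {n p} {P : Pred (Subset n) p} → Decidable P → (μ : Subset n → ℕ) →
                 (∀ q → ¬ P q) ⊎ ∃ λ q → P q × ∀ r → P r → μ r ≤ μ q
maximum-subset {zero} P? μ with P? []
... | yes P[] = inj₂ ([] , P[] , λ { [] _ → ≤-refl })
... | no ¬P[] = inj₁ λ { [] → ¬P[] }
maximum-subset {suc n} P? μ
  with maximum-subset (λ q → P? (inside ∷ q)) (λ q → μ (inside ∷ q))
     | maximum-subset (λ q → P? (outside ∷ q)) (λ q → μ (outside ∷ q))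
... | inj₁ ¬Pin | inj₁ ¬Pout = inj₁ λ { (true ∷ q) → ¬Pin q ; (false ∷ q) → ¬Pout q }
... | inj₂ (q , Pq , max) | inj₁ ¬Pout =
  inj₂ (inside ∷ q , Pq , λ { (true ∷ r) → max r ; (false ∷ r) Pr → ⊥-elim (¬Pout r Pr) })
... | inj₁ ¬Pin | inj₂ (q , Pq , max) =
  inj₂ (outside ∷ q , Pq , λ { (true ∷ r) Pr → ⊥-elim (¬Pin r Pr) ; (false ∷ r) → max r })
... | inj₂ (q , Pq , max) | inj₂ (q′ , Pq′ , max′) with ≤-total (μ (inside ∷ q)) (μ (outside ∷ q′))
...   | inj₁ ≤ =
  inj₂ (outside ∷ q′ , Pq′ , λ { (true ∷ r) Pr → ≤-trans (max r Pr) ≤ ; (false ∷ r) → max′ r })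
...   | inj₂ ≥ =
  inj₂ (inside ∷ q , Pq , λ { (true ∷ r) → max r ; (false ∷ r) Pr → ≤-trans (max′ r Pr) ≥ })

x∈p⇒0<∣p∣ : ∀ {n} {p : Subset n} {x} → x ∈ p → 0 < ∣ p ∣
x∈p⇒0<∣p∣ {p = p} {x} x∈p = subst (_≤ ∣ p ∣) (∣⁅x⁆∣≡1 x) (p⊆q⇒∣p∣≤∣q∣ ⁅x⁆⊆p)
  where
  ⁅x⁆⊆p : ⁅ x ⁆ ⊆ p
  ⁅x⁆⊆p y∈ = subst (_∈ p) (sym (x∈⁅y⁆⇒x≡y x y∈)) x∈p

-- Arithmetic of ⌈5w/4⌉

m*n≤o⇒m≤o/n : ∀ m n o .{{_ : NonZero n}} → m * n ≤ o → m ≤ o / n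
m*n≤o⇒m≤o/n m n o m*n≤o = subst (_≤ o / n) (m*n/n≡m m n) (/-monoˡ-≤ n m*n≤o)

ceil5/4-mono : ∀ {a b} → a ≤ b → ceil5/4 a ≤ ceil5/4 b
ceil5/4-mono a≤b = /-monoˡ-≤ 4 (+-monoˡ-≤ 3 (*-monoʳ-≤ 5 a≤b))

suc-ceil5/4≤ : ∀ {a b} → a < b → suc (ceil5/4 a) ≤ ceil5/4 b
suc-ceil5/4≤ {a} {suc b} (s≤s a≤b) = m*n≤o⇒m≤o/n (suc (ceil5/4 a)) 4 (5 * suc b + 3) (begin
  4 + ceil5/4 a * 4  ≤⟨ +-monoʳ-≤ 4 (m/n*n≤m (5 * a + 3) 4) ⟩
  4 + (5 * a + 3)    ≤⟨ +-monoʳ-≤ 4 (+-monoˡ-≤ 3 (*-monoʳ-≤ 5 a≤b)) ⟩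
  4 + (5 * b + 3)    ≡⟨ regroup b ⟩
  5 * suc b + 2      ≤⟨ +-monoʳ-≤ (5 * suc b) (n≤1+n 2) ⟩
  5 * suc b + 3      ∎)
  where
  open ≤-Reasoning
  regroup : ∀ b → 4 + (5 * b + 3) ≡ 5 * suc b + 2
  regroup = solve-∀

+-≤-ceil5/4 : ∀ {x y w} → x ≤ y → 2 * (x + y) ≡ w → x + w ≤ ceil5/4 w
+-≤-ceil5/4 {x} {y} {w} x≤y 2[x+y]≡w = m*n≤o⇒m≤o/n (x + w) 4 (5 * w + 3) (begin
  (x + w) * 4          ≡⟨ expand x w ⟩
  2 * (x + x) + 4 * w  ≤⟨ +-monoˡ-≤ (4 * w) (*-monoʳ-≤ 2 (+-monoʳ-≤ x x≤y)) ⟩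
  2 * (x + y) + 4 * w  ≡⟨ cong (_+ 4 * w) 2[x+y]≡w ⟩
  w + 4 * w            ≡⟨ collect w ⟩
  5 * w                ≤⟨ m≤m+n (5 * w) 3 ⟩
  5 * w + 3            ∎)
  where
  open ≤-Reasoning
  expand : ∀ x w → (x + w) * 4 ≡ 2 * (x + x) + 4 * w
  expand = solve-∀
  collect : ∀ w → w + 4 * w ≡ 5 * w
  collect = solve-∀

-- Colourings of finite graphs

squeeze : ∀ {k} (a b : Fin (suc (suc k))) → Fin (suc k)
squeeze a b with a Fin.≟ b
... | yes _   = zero
... | no a≢b = punchOut a≢b

squeeze-≢⇒≢-punchIn : ∀ {k} (a b : Fin (suc (suc k))) a′ → squeeze a b ≢ a′ → b ≢ punchIn a a′
squeeze-≢⇒≢-punchIn a b a′ ≢a′ with a Fin.≟ b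
... | yes refl = λ eq → punchInᵢ≢i a a′ (sym eq)
... | no a≢b  = λ eq → ≢a′ (punchIn-injective a _ _ (trans (punchIn-punchOut a≢b) eq))

-- If the first vertex of N has colour a, colour the rest with Fin (suc k) by squeezing a out;
-- a colour missed there, punched back in around a, is missed by c.
missing-colour : ∀ {n k} (N : Subset n) (c : ∀ u → u ∈ N → Fin k) → ∣ N ∣ < k →
                 ∃ λ a → ∀ u (u∈N : u ∈ N) → c u u∈N ≢ a
missing-colour {zero} {suc k} [] c _ = zero , λ _ ()
missing-colour {suc n} (false ∷ N) c ∣N∣<k with missing-colour N (λ u u∈N → c (suc u) (there u∈N)) ∣N∣<k
... | a , missed = a , λ { (suc u) (there u∈N) → missed u u∈N }
missing-colour {suc n} {suc (suc k)} (true ∷ N) c (s≤s ∣N∣<k)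
  with missing-colour N (λ u u∈N → squeeze (c zero here) (c (suc u) (there u∈N))) ∣N∣<k
... | a , missed = punchIn (c zero here) a , λ
  { zero    here        eq → punchInᵢ≢i (c zero here) a (sym eq)
  ; (suc u) (there u∈N) → squeeze-≢⇒≢-punchIn (c zero here) (c (suc u) (there u∈N)) a (missed u u∈N) }
missing-colour {suc n} {suc zero} (true ∷ N) c (s≤s ())

module _ {n} (G : Graph n) where

  IsStable : Subset n → Set
  IsStable I = ∀ u v → u ∈ I → v ∈ I → ¬ Adj G u v

  isClosedNeighbour? : ∀ v u → Dec (u ≡ v ⊎ Adj G v u)
  isClosedNeighbour? v u = (u Fin.≟ v) ⊎-dec adj? G v u

  closedNeighbourhood : Fin n → Subset n
  closedNeighbourhood v = subsetOf (isClosedNeighbour? v)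

  isClique? : ∀ S C → Dec (IsCliqueIn G S C)
  isClique? S C = (C ⊆? S) ×-dec all? λ u → all? λ v →
    u ∈? C →-dec (v ∈? C →-dec (¬? (u Fin.≟ v) →-dec adj? G u v))

  cliqueNumber-exists : ∀ S → ∃ (IsCliqueNumberIn G S)
  cliqueNumber-exists S with maximum-subset (isClique? S) ∣_∣
  ... | inj₁ noClique = ⊥-elim (noClique ⊥ (⊥⊆ , λ u _ u∈⊥ → ⊥-elim (∉⊥ u∈⊥)))
  ... | inj₂ (C , clique , max) = ∣ C ∣ , (C , clique , refl) , max

  colourable-by-some-clique : ∀ {S} {g : ℕ → ℕ} →
    (∀ w → IsCliqueNumberIn G S w → ColourableIn G S (g w)) →
    ∃ λ C → IsCliqueIn G S C × ColourableIn G S (g ∣ C ∣)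
  colourable-by-some-clique {S} bounded with cliqueNumber-exists S
  ... | w , ω@((C , clique , refl) , _) = C , clique , bounded w ω

  colourable-weaken : ∀ {S k k′} → k ≤ k′ → ColourableIn G S k → ColourableIn G S k′
  colourable-weaken k≤k′ (c , proper) =
    (λ v v∈ → inject≤ (c v v∈) k≤k′) ,
    λ u v u∈ v∈ uv eq → proper u v u∈ v∈ uv (inject≤-injective _ _ _ _ eq)

  colourable-by-stable-complement : ∀ {I k} → IsStable I → ColourableIn G (∁ I) k →
                                    ColourableIn G ⊤ (suc k)
  colourable-by-stable-complement {I} {k} stable (c , proper) = (λ v _ → colour v (v ∈? ∁ I)) , proper′
    where
    colour : ∀ v → Dec (v ∈ ∁ I) → Fin (suc k)
    colour v (yes v∈) = inject₁ (c v v∈)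
    colour v (no _)   = fromℕ k
    proper′ : ∀ u v (u∈ : u ∈ ⊤) (v∈ : v ∈ ⊤) → Adj G u v → colour u (u ∈? ∁ I) ≢ colour v (v ∈? ∁ I)
    proper′ u v _ _ uv with u ∈? ∁ I | v ∈? ∁ I
    ... | yes u∈ | yes v∈ = λ eq → proper u v u∈ v∈ uv (inject₁-injective eq)
    ... | yes _  | no _   = λ eq → fromℕ≢inject₁ (sym eq)
    ... | no _   | yes _  = fromℕ≢inject₁
    ... | no u∉  | no v∉  = ⊥-elim (stable u v (x∉∁p⇒x∈p u∉) (x∉∁p⇒x∈p v∉) uv)

  colourable-by-small-closed-neighbourhood : ∀ {v k} (D : Subset n) → closedNeighbourhood v ⊆ D →
    ∣ D ∣ ≤ k → ColourableIn G (∁ ⁅ v ⁆) k → ColourableIn G ⊤ k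
  colourable-by-small-closed-neighbourhood {v} {k} D N[v]⊆D ∣D∣≤k (c , proper) =
    (λ u _ → colour u (u Fin.≟ v)) , proper′
    where
    ≢v⇒∈ : ∀ {u} → u ≢ v → u ∈ ∁ ⁅ v ⁆
    ≢v⇒∈ u≢v = x∉p⇒x∈∁p (x≢y⇒x∉⁅y⁆ u≢v)
    N : Subset n
    N = D ∩ ∁ ⁅ v ⁆
    v∉N : v ∉ N
    v∉N v∈N = x∈∁p⇒x∉p (proj₂ (x∈p∩q⁻ D _ v∈N)) (x∈⁅x⁆ v)
    v∈D : v ∈ D
    v∈D = N[v]⊆D (∈-subsetOf⁺ (isClosedNeighbour? v) (inj₁ refl))
    ∣N∣<k : ∣ N ∣ < k
    ∣N∣<k = <-≤-trans (p⊂q⇒∣p∣<∣q∣ (p∩q⊆p D _ , v , v∈D , v∉N)) ∣D∣≤k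
    free : ∃ λ a → ∀ u (u∈N : u ∈ N) → c u (proj₂ (x∈p∩q⁻ D _ u∈N)) ≢ a
    free = missing-colour N (λ u u∈N → c u (proj₂ (x∈p∩q⁻ D _ u∈N))) ∣N∣<k
    colour : ∀ u → Dec (u ≡ v) → Fin k
    colour u (yes _)  = proj₁ free
    colour u (no u≢v) = c u (≢v⇒∈ u≢v)
    neighbour∈N : ∀ {u} → Adj G v u → u ∈ N
    neighbour∈N vu = x∈p∩q⁺ (N[v]⊆D (∈-subsetOf⁺ (isClosedNeighbour? v) (inj₂ vu)) ,
                             ≢v⇒∈ (λ { refl → irrefl G vu }))
    proper′ : ∀ u w (u∈ : u ∈ ⊤) (w∈ : w ∈ ⊤) → Adj G u w → colour u (u Fin.≟ v) ≢ colour w (w Fin.≟ v)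
    proper′ u w _ _ uw with u Fin.≟ v | w Fin.≟ v
    ... | yes refl | yes refl = ⊥-elim (irrefl G uw)
    ... | yes refl | no _     = λ eq →
      proj₂ free w (neighbour∈N uw) (trans (cong (c w) (∈-irrelevant _ _)) (sym eq))
    ... | no _     | yes refl = λ eq →
      proj₂ free u (neighbour∈N (Graph.sym G uw)) (trans (cong (c u) (∈-irrelevant _ _)) eq)
    ... | no u≢v   | no w≢v   = proper u w (≢v⇒∈ u≢v) (≢v⇒∈ w≢v) uw

-- Clique expansions

module CliqueExpansion {n m} {G : Graph n} {H : Graph m} {f : Fin n → Fin m}
                       (expansion : IsCliqueExpansion G (Adj H) f) where

  rep : Fin m → Fin n
  rep i = proj₁ (proj₁ expansion i)

  f∘rep : ∀ i → f (rep i) ≡ i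
  f∘rep i = proj₂ (proj₁ expansion i)

  adj⇒ : ∀ {u v} → u ≢ v → Adj G u v → f u ≡ f v ⊎ Adj H (f u) (f v)
  adj⇒ {u} {v} u≢v = Equivalence.to (proj₂ expansion u v u≢v)

  ⇒adj : ∀ {u v} → u ≢ v → f u ≡ f v ⊎ Adj H (f u) (f v) → Adj G u v
  ⇒adj {u} {v} u≢v = Equivalence.from (proj₂ expansion u v u≢v)

  preimage : Subset m → Subset n
  preimage X = subsetOf (λ v → f v ∈? X)

  ∈-preimage⁺ : ∀ {X v} → f v ∈ X → v ∈ preimage X
  ∈-preimage⁺ {X} = ∈-subsetOf⁺ (λ v → f v ∈? X)

  ∈-preimage⁻ : ∀ {X v} → v ∈ preimage X → f v ∈ X
  ∈-preimage⁻ {X} = ∈-subsetOf⁻ (λ v → f v ∈? X)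

  preimage-mono : ∀ {X Y} → X ⊆ Y → preimage X ⊆ preimage Y
  preimage-mono X⊆Y v∈ = ∈-preimage⁺ (X⊆Y (∈-preimage⁻ v∈))

  weight : Subset m → ℕ
  weight X = ∣ preimage X ∣

  weight-∪ : ∀ {X Y} → X ∩ Y ≡ ⊥ → weight (X ∪ Y) ≡ weight X + weight Y
  weight-∪ {X} {Y} X∩Y≡⊥ = begin
    ∣ preimage (X ∪ Y) ∣            ≡⟨ cong ∣_∣ (⊆-antisym ⊆∪ ∪⊆) ⟩
    ∣ preimage X ∪ preimage Y ∣     ≡⟨ ∣p∪q∣≡∣p∣+∣q∣ (Empty-unique disjoint) ⟩
    ∣ preimage X ∣ + ∣ preimage Y ∣ ∎
    where
    open ≡-Reasoning
    ⊆∪ : preimage (X ∪ Y) ⊆ preimage X ∪ preimage Y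
    ⊆∪ v∈ = x∈p∪q⁺ (⊎-map ∈-preimage⁺ ∈-preimage⁺ (x∈p∪q⁻ X Y (∈-preimage⁻ v∈)))
    ∪⊆ : preimage X ∪ preimage Y ⊆ preimage (X ∪ Y)
    ∪⊆ v∈ = ∈-preimage⁺ (x∈p∪q⁺ (⊎-map ∈-preimage⁻ ∈-preimage⁻ (x∈p∪q⁻ (preimage X) _ v∈)))
    disjoint : Empty (preimage X ∩ preimage Y)
    disjoint (v , v∈) = ∉⊥ (subst (f v ∈_) X∩Y≡⊥
      (x∈p∩q⁺ (×-map ∈-preimage⁻ ∈-preimage⁻ (x∈p∩q⁻ (preimage X) _ v∈))))

  weight-∪₃ : ∀ i j k → ⁅ i ⁆ ∩ (⁅ j ⁆ ∪ ⁅ k ⁆) ≡ ⊥ → ⁅ j ⁆ ∩ ⁅ k ⁆ ≡ ⊥ →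
              weight (⁅ i ⁆ ∪ ⁅ j ⁆ ∪ ⁅ k ⁆) ≡ weight ⁅ i ⁆ + (weight ⁅ j ⁆ + weight ⁅ k ⁆)
  weight-∪₃ i j k i∉jk j∉k = trans (weight-∪ i∉jk) (cong (weight ⁅ i ⁆ +_) (weight-∪ j∉k))

  rep∈preimage : ∀ {X i} → i ∈ X → rep i ∈ preimage X
  rep∈preimage {X} {i} i∈X = ∈-preimage⁺ (subst (_∈ X) (sym (f∘rep i)) i∈X)

  0<weight : ∀ {X} → Nonempty X → 0 < weight X
  0<weight (i , i∈X) = x∈p⇒0<∣p∣ (rep∈preimage i∈X)

  preimage-clique : ∀ {K} → IsCliqueIn H ⊤ K → IsCliqueIn G ⊤ (preimage K)
  preimage-clique {K} (_ , K-clique) = (λ _ → ∈⊤) , adjacent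
    where
    adjacent : ∀ u v → u ∈ preimage K → v ∈ preimage K → u ≢ v → Adj G u v
    adjacent u v u∈ v∈ u≢v with f u Fin.≟ f v
    ... | yes fu≡fv = ⇒adj u≢v (inj₁ fu≡fv)
    ... | no fu≢fv  = ⇒adj u≢v (inj₂ (K-clique _ _ (∈-preimage⁻ u∈) (∈-preimage⁻ v∈) fu≢fv))

  hasPreimageIn? : ∀ C i → Dec (∃ λ v → v ∈ C × f v ≡ i)
  hasPreimageIn? C i = any? (λ v → (v ∈? C) ×-dec (f v Fin.≟ i))

  image : Subset n → Subset m
  image C = subsetOf (hasPreimageIn? C)

  ⊆-preimage-image : ∀ {C} → C ⊆ preimage (image C)
  ⊆-preimage-image {C} {v} v∈ = ∈-preimage⁺ (∈-subsetOf⁺ (hasPreimageIn? C) (v , v∈ , refl))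

  image-clique : ∀ {S C} → IsCliqueIn G S C → IsCliqueIn H ⊤ (image C)
  image-clique {S} {C} (_ , C-clique) = (λ _ → ∈⊤) , adjacent
    where
    adjacent : ∀ i j → i ∈ image C → j ∈ image C → i ≢ j → Adj H i j
    adjacent i j i∈ j∈ i≢j
      with ∈-subsetOf⁻ (hasPreimageIn? C) i∈ | ∈-subsetOf⁻ (hasPreimageIn? C) j∈
    ... | u , u∈ , refl | v , v∈ , refl
      with adj⇒ (λ { refl → i≢j refl }) (C-clique u v u∈ v∈ (λ { refl → i≢j refl }))
    ...   | inj₁ fu≡fv = ⊥-elim (i≢j fu≡fv)
    ...   | inj₂ fufv  = fufv

  isRepresentativeIn? : ∀ X v → Dec (f v ∈ X × v ≡ rep (f v))
  isRepresentativeIn? X v = (f v ∈? X) ×-dec (v Fin.≟ rep (f v))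

  representatives : Subset m → Subset n
  representatives X = subsetOf (isRepresentativeIn? X)

  rep∈representatives : ∀ {X i} → i ∈ X → rep i ∈ representatives X
  rep∈representatives {X} {i} i∈X = ∈-subsetOf⁺ (isRepresentativeIn? X)
    (subst (_∈ X) (sym (f∘rep i)) i∈X , cong rep (sym (f∘rep i)))

  representatives-stable : ∀ {X} → IsStable H X → IsStable G (representatives X)
  representatives-stable {X} X-stable u v u∈ v∈ uv
    with ∈-subsetOf⁻ (isRepresentativeIn? X) u∈ | ∈-subsetOf⁻ (isRepresentativeIn? X) v∈
  ... | fu∈X , u≡rep | fv∈X , v≡rep with adj⇒ (λ { refl → irrefl G uv }) uv
  ...   | inj₂ fufv  = X-stable (f u) (f v) fu∈X fv∈X fufv
  ...   | inj₁ fu≡fv = irrefl G (subst (Adj G u) v≡u uv)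
    where
    v≡u : v ≡ u
    v≡u = trans v≡rep (trans (cong rep (sym fu≡fv)) (sym u≡rep))

  closedNeighbourhood-⊆ : ∀ v → closedNeighbourhood G v ⊆ preimage (closedNeighbourhood H (f v))
  closedNeighbourhood-⊆ v {u} u∈ =
    ∈-preimage⁺ (∈-subsetOf⁺ (isClosedNeighbour? H (f v)) (image-of (∈-subsetOf⁻ (isClosedNeighbour? G v) u∈)))
    where
    image-of : u ≡ v ⊎ Adj G v u → f u ≡ f v ⊎ Adj H (f v) (f u)
    image-of (inj₁ refl) = inj₁ refl
    image-of (inj₂ vu) with adj⇒ (λ { refl → irrefl G vu }) vu
    ... | inj₁ fv≡fu = inj₁ (sym fv≡fu)
    ... | inj₂ fvfu  = inj₂ fvfu

-- The graph G₇

G7Adj? : ∀ u v → Dec (G7Adj u v)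
G7Adj? u v = T? (e7 (toℕ u) (toℕ v) ∨ e7 (toℕ v) (toℕ u))

G7 : Graph 8
G7 = record
  { Adj    = G7Adj
  ; adj?   = G7Adj?
  ; sym    = λ {u} {v} → subst T (∨-comm (e7 (toℕ u) (toℕ v)) _)
  ; irrefl = λ {u} → from-yes (all? λ u → ¬? (G7Adj? u u)) u
  }

maxClique : Fin 9 → Subset 8
maxClique = lookup
  ( ⁅ # 0 ⁆ ∪ ⁅ # 1 ⁆ ∪ ⁅ # 2 ⁆ ∷ ⁅ # 3 ⁆ ∪ ⁅ # 4 ⁆ ∪ ⁅ # 5 ⁆
  ∷ ⁅ # 0 ⁆ ∪ ⁅ # 3 ⁆ ∷ ⁅ # 1 ⁆ ∪ ⁅ # 4 ⁆ ∷ ⁅ # 2 ⁆ ∪ ⁅ # 5 ⁆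
  ∷ ⁅ # 0 ⁆ ∪ ⁅ # 6 ⁆ ∷ ⁅ # 4 ⁆ ∪ ⁅ # 6 ⁆ ∷ ⁅ # 1 ⁆ ∪ ⁅ # 7 ⁆ ∷ ⁅ # 3 ⁆ ∪ ⁅ # 7 ⁆ ∷ [])

stableSet : Fin 8 → Subset 8
stableSet = lookup
  ( ⁅ # 0 ⁆ ∪ ⁅ # 4 ⁆ ∪ ⁅ # 7 ⁆ ∷ ⁅ # 0 ⁆ ∪ ⁅ # 5 ⁆ ∪ ⁅ # 7 ⁆ ∷ ⁅ # 1 ⁆ ∪ ⁅ # 3 ⁆ ∪ ⁅ # 6 ⁆
  ∷ ⁅ # 1 ⁆ ∪ ⁅ # 5 ⁆ ∪ ⁅ # 6 ⁆ ∷ ⁅ # 2 ⁆ ∪ ⁅ # 3 ⁆ ∪ ⁅ # 6 ⁆ ∷ ⁅ # 2 ⁆ ∪ ⁅ # 4 ⁆ ∪ ⁅ # 7 ⁆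
  ∷ ⁅ # 2 ⁆ ∪ ⁅ # 6 ⁆ ∪ ⁅ # 7 ⁆ ∷ ⁅ # 5 ⁆ ∪ ⁅ # 6 ⁆ ∪ ⁅ # 7 ⁆ ∷ [])

-- Checked by exhaustive evaluation; opaque stops the checker from re-running it at every use.
opaque
  maxClique-clique : ∀ c → IsCliqueIn G7 ⊤ (maxClique c)
  maxClique-clique = from-yes (all? λ c → isClique? G7 ⊤ (maxClique c))

  maxClique-nonempty : ∀ c → Nonempty (maxClique c)
  maxClique-nonempty = from-yes (all? λ c → nonempty? (maxClique c))

  clique-⊆-maxClique : ∀ K → IsCliqueIn G7 ⊤ K → ∃ λ c → K ⊆ maxClique c
  clique-⊆-maxClique = from-yes (allSubset? λ K → isClique? G7 ⊤ K →-dec any? λ c → K ⊆? maxClique c)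

  stableSet-stable : ∀ s → IsStable G7 (stableSet s)
  stableSet-stable = from-yes (all? λ s → all? λ u → all? λ v →
    u ∈? stableSet s →-dec (v ∈? stableSet s →-dec ¬? (G7Adj? u v)))

  stableSet-nonempty : ∀ s → Nonempty (stableSet s)
  stableSet-nonempty = from-yes (all? λ s → nonempty? (stableSet s))

-- Cliques 2, 3, 4 are the matching edges x₁x₄, x₂x₅, x₃x₆; outerCliques omits the first two.
outerCliques : Subset 9
outerCliques = ∁ (⁅ # 2 ⁆ ∪ ⁅ # 3 ⁆)

HitsAll : Subset 9 → Fin 8 → Set
HitsAll T s = ∀ c → c ∈ T → Nonempty (stableSet s ∩ maxClique c)

TwoMatchingEdges : Subset 9 → Set
TwoMatchingEdges T = (# 2 ∈ T × # 3 ∈ T) ⊎ (# 2 ∈ T × # 4 ∈ T) ⊎ (# 3 ∈ T × # 4 ∈ T)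

opaque
  tight-cases : ∀ T → ∃ (HitsAll T) ⊎ outerCliques ⊆ T ⊎ TwoMatchingEdges T
  tight-cases = from-yes (allSubset? λ T →
    any? (λ s → all? λ c → c ∈? T →-dec nonempty? (stableSet s ∩ maxClique c)) ⊎-dec
    outerCliques ⊆? T ⊎-dec
    ((# 2 ∈? T) ×-dec (# 3 ∈? T)) ⊎-dec ((# 2 ∈? T) ×-dec (# 4 ∈? T)) ⊎-dec ((# 3 ∈? T) ×-dec (# 4 ∈? T)))

-- a (# (i - 1)) is the weight of xᵢ; the hypotheses say that all maximal cliques but x₁x₄ and x₂x₅
-- are tight. Then a₁ = a₅ and a₂ = a₄, so the two triangles give 2 (a₁ + a₂) = w, and the smaller of
-- a₁, a₂ is at most w / 4.
light-x₇-or-x₈ : ∀ (a : Fin 8 → ℕ) {w} →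
  a (# 0) + (a (# 1) + a (# 2)) ≡ w → a (# 3) + (a (# 4) + a (# 5)) ≡ w → a (# 2) + a (# 5) ≡ w →
  a (# 0) + a (# 6) ≡ w → a (# 4) + a (# 6) ≡ w → a (# 1) + a (# 7) ≡ w → a (# 3) + a (# 7) ≡ w →
  a (# 0) + (a (# 4) + a (# 6)) ≤ ceil5/4 w ⊎ a (# 1) + (a (# 3) + a (# 7)) ≤ ceil5/4 w
light-x₇-or-x₈ a {w} x₁x₂x₃ x₄x₅x₆ x₃x₆ x₁x₇ x₅x₇ x₂x₈ x₄x₈ = smaller-side (≤-total a₁ a₂)
  where
  a₁ = a (# 0); a₂ = a (# 1); a₃ = a (# 2); a₄ = a (# 3)
  a₅ = a (# 4); a₆ = a (# 5); a₇ = a (# 6); a₈ = a (# 7)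
  a₁≡a₅ : a₁ ≡ a₅
  a₁≡a₅ = +-cancelʳ-≡ a₇ a₁ a₅ (trans x₁x₇ (sym x₅x₇))
  a₂≡a₄ : a₂ ≡ a₄
  a₂≡a₄ = +-cancelʳ-≡ a₈ a₂ a₄ (trans x₂x₈ (sym x₄x₈))
  regroup : ∀ a₁ a₂ a₃ a₆ → 2 * (a₁ + a₂) + (a₃ + a₆) ≡ (a₁ + (a₂ + a₃)) + (a₂ + (a₁ + a₆))
  regroup = solve-∀
  double : 2 * (a₁ + a₂) ≡ w
  double = +-cancelʳ-≡ w _ _ (begin
    2 * (a₁ + a₂) + w                    ≡⟨ cong (2 * (a₁ + a₂) +_) (sym x₃x₆) ⟩
    2 * (a₁ + a₂) + (a₃ + a₆)            ≡⟨ regroup a₁ a₂ a₃ a₆ ⟩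
    (a₁ + (a₂ + a₃)) + (a₂ + (a₁ + a₆))  ≡⟨ cong₂ (λ x y → (a₁ + (a₂ + a₃)) + (x + (y + a₆))) a₂≡a₄ a₁≡a₅ ⟩
    (a₁ + (a₂ + a₃)) + (a₄ + (a₅ + a₆))  ≡⟨ cong₂ _+_ x₁x₂x₃ x₄x₅x₆ ⟩
    w + w                                ∎)
    where open ≡-Reasoning
  smaller-side : a₁ ≤ a₂ ⊎ a₂ ≤ a₁ → a₁ + (a₅ + a₇) ≤ ceil5/4 w ⊎ a₂ + (a₄ + a₈) ≤ ceil5/4 w
  smaller-side (inj₁ a₁≤a₂) = inj₁ (subst (λ z → a₁ + z ≤ ceil5/4 w) (sym x₅x₇) (+-≤-ceil5/4 a₁≤a₂ double))
  smaller-side (inj₂ a₂≤a₁) = inj₂ (subst (λ z → a₂ + z ≤ ceil5/4 w) (sym x₄x₈)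
    (+-≤-ceil5/4 a₂≤a₁ (trans (cong (2 *_) (+-comm a₂ a₁)) double)))

no-two-of-three-≡ : ∀ {x₁ x₂ y₁ y₂ y₃ w} → x₁ ≤ w → x₂ ≤ w → x₁ + x₂ ≡ y₁ + (y₂ + y₃) →
  0 < y₁ → 0 < y₂ → 0 < y₃ → ¬ ((y₁ ≡ w × y₂ ≡ w) ⊎ (y₁ ≡ w × y₃ ≡ w) ⊎ (y₂ ≡ w × y₃ ≡ w))
no-two-of-three-≡ {y₁ = y₁} {y₂} {y₃} {w} x₁≤w x₂≤w x≡y 0<y₁ 0<y₂ 0<y₃ two =
  <-irrefl refl (≤-<-trans (≤-trans (≤-reflexive (sym x≡y)) (+-mono-≤ x₁≤w x₂≤w)) (exceeds two))
  where
  exceeds : (y₁ ≡ w × y₂ ≡ w) ⊎ (y₁ ≡ w × y₃ ≡ w) ⊎ (y₂ ≡ w × y₃ ≡ w) → w + w < y₁ + (y₂ + y₃)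
  exceeds (inj₁ (refl , refl))        = +-monoʳ-< w (m<m+n w 0<y₃)
  exceeds (inj₂ (inj₁ (refl , refl))) = +-monoʳ-< w (m<n+m w 0<y₂)
  exceeds (inj₂ (inj₂ (refl , refl))) = m<n+m (w + w) 0<y₁

module G7Expansion {n} {G : Graph n} {f : Fin n → Fin 8} (expansion : IsCliqueExpansion G G7Adj f)
  (minimal : ∀ S → (∃ λ v → v ∉ S) → ∀ w → IsCliqueNumberIn G S w → ColourableIn G S (ceil5/4 w))
  {ω : ℕ} (ω-clique-number : IsCliqueNumberIn G ⊤ ω) where

  open CliqueExpansion {G = G} {H = G7} {f = f} expansion

  W : Fin 9 → ℕ
  W c = weight (maxClique c)

  a : Fin 8 → ℕ
  a i = weight ⁅ i ⁆

  W≤ω : ∀ c → W c ≤ ω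
  W≤ω c = proj₂ ω-clique-number _ (preimage-clique (maxClique-clique c))

  ⊆-preimage-maxClique : ∀ {S C} → IsCliqueIn G S C → ∃ λ c → C ⊆ preimage (maxClique c)
  ⊆-preimage-maxClique {C = C} clique =
    let c , image⊆ = clique-⊆-maxClique (image C) (image-clique clique)
    in c , λ v∈ → preimage-mono image⊆ (⊆-preimage-image v∈)

  isTight? : ∀ c → Dec (W c ≡ ω)
  isTight? c = W c ≟ℕ ω

  tight : Subset 9
  tight = subsetOf isTight?

  ∈-tight⁺ : ∀ {c} → W c ≡ ω → c ∈ tight
  ∈-tight⁺ = ∈-subsetOf⁺ isTight?

  ∈-tight⁻ : ∀ {c} → c ∈ tight → W c ≡ ω
  ∈-tight⁻ = ∈-subsetOf⁻ isTight?

  -- C lies in the preimage of a maximal clique c; if c is tight, the representative of a vertex of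
  -- s ∩ c is a vertex of that preimage outside C.
  cliques-avoiding-representatives-<ω : ∀ s → HitsAll tight s →
    ∀ {C} → IsCliqueIn G (∁ (representatives (stableSet s))) C → ∣ C ∣ < ω
  cliques-avoiding-representatives-<ω s hits {C} clique with ⊆-preimage-maxClique clique
  ... | c , C⊆ with W c ≟ℕ ω
  ...   | no W≢ω = ≤-<-trans (p⊆q⇒∣p∣≤∣q∣ C⊆) (≤∧≢⇒< (W≤ω c) W≢ω)
  ...   | yes W≡ω with hits c (∈-tight⁺ W≡ω)
  ...     | i , i∈s∩c = <-≤-trans (p⊂q⇒∣p∣<∣q∣ (C⊆ , rep i , rep∈preimage i∈c , rep∉C)) (W≤ω c)
    where
    i∈c : i ∈ maxClique c
    i∈c = proj₂ (x∈p∩q⁻ (stableSet s) (maxClique c) i∈s∩c)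
    rep∉C : rep i ∉ C
    rep∉C rep∈C = x∈p⇒x∉∁p (rep∈representatives (proj₁ (x∈p∩q⁻ (stableSet s) (maxClique c) i∈s∩c)))
                           (proj₁ clique rep∈C)

  colourable-by-stableSet : ∀ s → HitsAll tight s → ColourableIn G ⊤ (ceil5/4 ω)
  colourable-by-stableSet s hits =
    let i₀ , i₀∈s = stableSet-nonempty s
        C , clique , colouring = colourable-by-some-clique G
          (minimal (∁ (representatives (stableSet s))) (rep i₀ , x∈p⇒x∉∁p (rep∈representatives i₀∈s)))
    in colourable-weaken G (suc-ceil5/4≤ (cliques-avoiding-representatives-<ω s hits clique))
         (colourable-by-stable-complement G (representatives-stable (stableSet-stable s)) colouring)

  colourable-by-light-vertex : ∀ x → weight (closedNeighbourhood G7 x) ≤ ceil5/4 ω →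
                               ColourableIn G ⊤ (ceil5/4 ω)
  colourable-by-light-vertex x light =
    let C , clique , colouring = colourable-by-some-clique G
          (minimal (∁ ⁅ rep x ⁆) (rep x , x∈p⇒x∉∁p (x∈⁅x⁆ (rep x))))
        ∣C∣≤ω = proj₂ ω-clique-number C ((λ _ → ∈⊤) , proj₂ clique)
    in colourable-by-small-closed-neighbourhood G (preimage (closedNeighbourhood G7 x))
         N[rep]⊆ light (colourable-weaken G (ceil5/4-mono ∣C∣≤ω) colouring)
    where
    N[rep]⊆ : closedNeighbourhood G (rep x) ⊆ preimage (closedNeighbourhood G7 x)
    N[rep]⊆ = subst (λ y → closedNeighbourhood G (rep x) ⊆ preimage (closedNeighbourhood G7 y))
                      (f∘rep x) (closedNeighbourhood-⊆ (rep x))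

  colourable-if-outer-tight : outerCliques ⊆ tight → ColourableIn G ⊤ (ceil5/4 ω)
  colourable-if-outer-tight outer⊆tight =
    [ (λ x₇-light → colourable-by-light-vertex (# 6)
                      (subst (_≤ ceil5/4 ω) (sym (weight-∪₃ (# 0) (# 4) (# 6) refl refl)) x₇-light))
    , (λ x₈-light → colourable-by-light-vertex (# 7)
                      (subst (_≤ ceil5/4 ω) (sym (weight-∪₃ (# 1) (# 3) (# 7) refl refl)) x₈-light))
    ]′ (light-x₇-or-x₈ a W₀ W₁ W₄ W₅ W₆ W₇ W₈)
    where
    tight-outer : ∀ c {c∈ : True (c ∈? outerCliques)} → W c ≡ ω
    tight-outer c {c∈} = ∈-tight⁻ (outer⊆tight (toWitness c∈))
    W₀ : a (# 0) + (a (# 1) + a (# 2)) ≡ ω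
    W₀ = trans (sym (weight-∪₃ (# 0) (# 1) (# 2) refl refl)) (tight-outer (# 0))
    W₁ : a (# 3) + (a (# 4) + a (# 5)) ≡ ω
    W₁ = trans (sym (weight-∪₃ (# 3) (# 4) (# 5) refl refl)) (tight-outer (# 1))
    W₄ : a (# 2) + a (# 5) ≡ ω
    W₄ = trans (sym (weight-∪ refl)) (tight-outer (# 4))
    W₅ : a (# 0) + a (# 6) ≡ ω
    W₅ = trans (sym (weight-∪ refl)) (tight-outer (# 5))
    W₆ : a (# 4) + a (# 6) ≡ ω
    W₆ = trans (sym (weight-∪ refl)) (tight-outer (# 6))
    W₇ : a (# 1) + a (# 7) ≡ ω
    W₇ = trans (sym (weight-∪ refl)) (tight-outer (# 7))
    W₈ : a (# 3) + a (# 7) ≡ ω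
    W₈ = trans (sym (weight-∪ refl)) (tight-outer (# 8))

  not-two-matching-edges-tight : ¬ TwoMatchingEdges tight
  not-two-matching-edges-tight two =
    no-two-of-three-≡ (W≤ω (# 0)) (W≤ω (# 1)) triangles≡matching
      (0<weight (maxClique-nonempty (# 2))) (0<weight (maxClique-nonempty (# 3)))
      (0<weight (maxClique-nonempty (# 4)))
      (⊎-map both-tight (⊎-map both-tight both-tight) two)
    where
    both-tight : ∀ {c d} → c ∈ tight × d ∈ tight → W c ≡ ω × W d ≡ ω
    both-tight = ×-map ∈-tight⁻ ∈-tight⁻
    regroup : ∀ a₁ a₂ a₃ a₄ a₅ a₆ →
              (a₁ + (a₂ + a₃)) + (a₄ + (a₅ + a₆)) ≡ (a₁ + a₄) + ((a₂ + a₅) + (a₃ + a₆))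
    regroup = solve-∀
    triangles≡matching : W (# 0) + W (# 1) ≡ W (# 2) + (W (# 3) + W (# 4))
    triangles≡matching = begin
      W (# 0) + W (# 1)
        ≡⟨ cong₂ _+_ (weight-∪₃ (# 0) (# 1) (# 2) refl refl) (weight-∪₃ (# 3) (# 4) (# 5) refl refl) ⟩
      (a (# 0) + (a (# 1) + a (# 2))) + (a (# 3) + (a (# 4) + a (# 5)))
        ≡⟨ regroup (a (# 0)) (a (# 1)) (a (# 2)) (a (# 3)) (a (# 4)) (a (# 5)) ⟩
      (a (# 0) + a (# 3)) + ((a (# 1) + a (# 4)) + (a (# 2) + a (# 5)))
        ≡⟨ sym (cong₂ _+_ (weight-∪ refl) (cong₂ _+_ (weight-∪ refl) (weight-∪ refl))) ⟩
      W (# 2) + (W (# 3) + W (# 4)) ∎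
      where open ≡-Reasoning

theorem8 : ∀ {n} (G : Graph n) (f : Fin n → Fin 8) → IsCliqueExpansion G G7Adj f → (∀ (S : Subset n) → (∃ λ v → v ∉ S) → ∀ w → IsCliqueNumberIn G S w → ColourableIn G S (ceil5/4 w)) → ∀ w → IsCliqueNumberIn G ⊤ w → ColourableIn G ⊤ (ceil5/4 w)
theorem8 G f expansion minimal ω ω-clique-number =
  [ uncurry colourable-by-stableSet
  , [ colourable-if-outer-tight , (λ two → ⊥-elim (not-two-matching-edges-tight two)) ]′
  ]′ (tight-cases tight)
  where open G7Expansion {G = G} {f = f} expansion minimal ω-clique-number
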